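{- Let $S$ be an S-tree and let $U\subseteq\operatorname{Core}(S)$ be nonempty. Then $|N(U)\cap\operatorname{Supp}(S)|>|U|$.
   Context: For a tree $S$, $\mathcal{N}(S)$ is the null space of its adjacency matrix and $\operatorname{Supp}(S)=\{w\in V(S): x_w\neq0\text{ for some }x\in\mathcal{N}(S)\}$. $S$ is an S-tree if $N[\operatorname{Supp}(S)]=V(S)$. For $X\subseteq V(S)$, $N(X)=\bigcup_{w\in X}N(w)$ and $N[X]=\bigcup_{w\in X}(N(w)\cup\{w\})$. $\operatorname{Core}(S)=N(\operatorname{Supp}(S))$. -}

module Defs where

open import Data.Nat using (ℕ; _+_; _*_; _<_)
open import Data.Bool using (Bool; true; false; T; if_then_else_)
open import Data.Fin using (Fin; zero; suc)
open import Data.Fin.Subset using (Subset; _∈_; ∣_∣; Nonempty)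
open import Data.Product using (Σ; ∃; _×_; _,_)
open import Data.Sum using (_⊎_)
open import Relation.Nullary using (¬_)
open import Relation.Binary.PropositionalEquality using (_≡_)
open import Relation.Binary.Construct.Closure.ReflexiveTransitive using (Star)
open import Data.Rational as ℚ using (ℚ; 0ℚ; 1ℚ)

sumℕ : ∀ {n} → (Fin n → ℕ) → ℕ
sumℕ {ℕ.zero}  f = 0
sumℕ {ℕ.suc n} f = f zero + sumℕ (λ i → f (suc i))

sumℚ : ∀ {n} → (Fin n → ℚ) → ℚ
sumℚ {ℕ.zero}  f = 0ℚ
sumℚ {ℕ.suc n} f = f zero ℚ.+ sumℚ (λ i → f (suc i))

record Graph (n : ℕ) : Set where
  field
    adj   : Fin n → Fin n → Bool
    sym   : ∀ i j → adj i j ≡ adj j i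
    irrefl : ∀ i → adj i i ≡ false

module _ {n : ℕ} (G : Graph n) where
  open Graph G

  Adj : Fin n → Fin n → Set
  Adj i j = T (adj i j)

  bool→ℕ : Bool → ℕ
  bool→ℕ b = if b then 1 else 0

  -- number of edges, counted twice (sum of degrees)
  degreeSum : ℕ
  degreeSum = sumℕ (λ i → sumℕ (λ j → bool→ℕ (adj i j)))

  Connected : Set
  Connected = ∀ i j → Star Adj i j

  A : Fin n → Fin n → ℚ
  A i j = if adj i j then 1ℚ else 0ℚ

  InNullSpace : (Fin n → ℚ) → Set
  InNullSpace x = ∀ i → sumℚ (λ j → A i j ℚ.* x j) ≡ 0ℚ

  InSupp : Fin n → Set
  InSupp w = Σ (Fin n → ℚ) λ x → InNullSpace x × ¬ (x w ≡ 0ℚ)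

  InN : (Fin n → Set) → Fin n → Set
  InN X v = ∃ λ w → X w × Adj w v

  InNClosed : (Fin n → Set) → Fin n → Set
  InNClosed X v = X v ⊎ InN X v

  InCore : Fin n → Set
  InCore = InN InSupp

  IsSTree : Set
  IsSTree = ∀ v → InNClosed InSupp v

-- a tree: a connected simple graph on n = suc m ≥ 1 vertices with n - 1 edges
record IsTree {n : ℕ} (G : Graph n) : Set where
  field
    nonempty  : 0 < n
    connected : Connected G
    edges     : degreeSum G + 2 ≡ 2 * n

module Submission where

-- Let S be a tree, U ⊆ Core(S) nonempty and W = N(U) ∩ Supp(S).  The proof
-- combines one fact from linear algebra with one from counting edges.
--
-- * Linear algebra: if x is in the null space of the adjacency matrix, a
--   vertex u adjacent to some t with x_t ≠ 0 has a second neighbour t' ≠ t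
--   with x_t' ≠ 0, since otherwise (Ax)_u = x_t ≠ 0.  Hence every vertex
--   of U has two distinct neighbours in W.
-- * Counting: in a tree every nonempty vertex set Y spans at most |Y| - 1
--   edges (grow Y one neighbouring vertex at a time until it is the whole
--   tree, which has n - 1 edges).  From this we derive an expansion lemma:
--   if every vertex of a nonempty set A has two neighbours in B, then
--   |A| < |B|.  Indeed, writing e(A,B) for the number of adjacent ordered
--   pairs in A × B,  4|A| ≤ e(A,B) + e(B,A) ≤ e(A∪B) + e(A∩B)
--   ≤ 2(|A∪B| - 1) + 2|A∩B| = 2|A| + 2|B| - 2.

open import Defs
open import Data.Nat using (ℕ; zero; suc; _+_; _*_; _≤_; _<_; z≤n; _≤ᵇ_)
open import Data.Nat.Properties hiding (_≟_; suc-injective)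
open import Data.Bool using (Bool; true; false; T; _∧_; _∨_; not)
open import Data.Bool.Properties using (∧-comm; ∧-zeroʳ; ∧-identityʳ; T-≡)
open import Data.Fin using (Fin; zero; suc)
open import Data.Fin.Properties using (_≟_; any?; suc-injective)
open import Data.Fin.Subset using (Subset; _∈_; ∣_∣; Nonempty)
open import Data.Vec using ([]; _∷_; lookup)
open import Data.Vec.Properties using ([]=⇒lookup; lookup⇒[]=)
open import Data.Product using (∃; ∃₂; _×_; _,_)
open import Data.Rational as ℚ using (ℚ; 0ℚ; 1ℚ)
import Data.Rational.Properties as ℚ
open import Data.Empty using (⊥-elim)
open import Function.Bundles using (_⇔_; Equivalence)
open import Relation.Nullary using (yes; no; ¬?; _×-dec_)
open import Relation.Nullary.Decidable using (⌊_⌋; T?)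
open import Relation.Binary.PropositionalEquality
open import Relation.Binary.Construct.Closure.ReflexiveTransitive using (Star; ε; _◅_)
open import Data.Nat.Tactic.RingSolver using (solve-∀)
import Algebra.Properties.Semiring.Sum as SemiringSum

⟦_⟧ : Bool → ℕ
⟦ true ⟧ = 1
⟦ false ⟧ = 0

by-computation : ∀ m n → {T (m ≤ᵇ n)} → m ≤ n
by-computation m n {p} = ≤ᵇ⇒≤ m n p

module Σℕ = SemiringSum +-*-semiring

sumℕ≡sum : ∀ {n} (f : Fin n → ℕ) → sumℕ f ≡ Σℕ.sum f
sumℕ≡sum {zero} f = refl
sumℕ≡sum {suc n} f = cong (f zero +_) (sumℕ≡sum (λ i → f (suc i)))

sum-cong : ∀ {n} {f g : Fin n → ℕ} → (∀ i → f i ≡ g i) → sumℕ f ≡ sumℕ g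
sum-cong {zero} h = refl
sum-cong {suc n} h = cong₂ _+_ (h zero) (sum-cong (λ i → h (suc i)))

sum-mono : ∀ {n} {f g : Fin n → ℕ} → (∀ i → f i ≤ g i) → sumℕ f ≤ sumℕ g
sum-mono {zero} h = z≤n
sum-mono {suc n} h = +-mono-≤ (h zero) (sum-mono (λ i → h (suc i)))

sum-+ : ∀ {n} (f g : Fin n → ℕ) → sumℕ (λ i → f i + g i) ≡ sumℕ f + sumℕ g
sum-+ f g = begin
  sumℕ (λ i → f i + g i)     ≡⟨ sumℕ≡sum (λ i → f i + g i) ⟩
  Σℕ.sum (λ i → f i + g i)   ≡⟨ Σℕ.∑-distrib-+ f g ⟩
  Σℕ.sum f + Σℕ.sum g        ≡⟨ cong₂ _+_ (sumℕ≡sum f) (sumℕ≡sum g) ⟨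
  sumℕ f + sumℕ g            ∎
  where open ≡-Reasoning

sum-* : ∀ {n} c (f : Fin n → ℕ) → sumℕ (λ i → c * f i) ≡ c * sumℕ f
sum-* c f = begin
  sumℕ (λ i → c * f i)     ≡⟨ sumℕ≡sum (λ i → c * f i) ⟩
  Σℕ.sum (λ i → c * f i)   ≡⟨ Σℕ.*-distribˡ-sum c f ⟨
  c * Σℕ.sum f             ≡⟨ cong (c *_) (sumℕ≡sum f) ⟨
  c * sumℕ f               ∎
  where open ≡-Reasoning

sum-swap : ∀ {m n} (f : Fin m → Fin n → ℕ) →
           sumℕ (λ i → sumℕ (f i)) ≡ sumℕ (λ j → sumℕ (λ i → f i j))
sum-swap f = trans (nested f) (trans (Σℕ.∑-comm f) (sym (nested (λ j i → f i j))))
  where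
    nested : ∀ {m n} (g : Fin m → Fin n → ℕ) →
             sumℕ (λ i → sumℕ (g i)) ≡ Σℕ.sum (λ i → Σℕ.sum (g i))
    nested g = trans (sumℕ≡sum (λ i → sumℕ (g i))) (Σℕ.sum-cong-≗ (λ i → sumℕ≡sum (g i)))

sum-zero : ∀ {n} {f : Fin n → ℕ} → (∀ i → f i ≡ 0) → sumℕ f ≡ 0
sum-zero {zero} h = refl
sum-zero {suc n} h rewrite h zero = sum-zero (λ i → h (suc i))

sum-single : ∀ {n} {f : Fin n → ℕ} (t : Fin n) → (∀ j → j ≢ t → f j ≡ 0) → sumℕ f ≡ f t
sum-single {suc n} {f} zero h =
  trans (cong (f zero +_) (sum-zero (λ i → h (suc i) (λ ())))) (+-identityʳ (f zero))
sum-single {suc n} {f} (suc t) h rewrite h zero (λ ()) =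
  sum-single {f = λ i → f (suc i)} t (λ j j≢t → h (suc j) (λ e → j≢t (suc-injective e)))

sum-≥-term : ∀ {n} (f : Fin n → ℕ) t → f t ≤ sumℕ f
sum-≥-term f zero = m≤m+n (f zero) _
sum-≥-term f (suc t) = ≤-trans (sum-≥-term (λ i → f (suc i)) t) (m≤n+m _ (f zero))

sum-≥-two-terms : ∀ {n} (f : Fin n → ℕ) {s t} → s ≢ t → f s + f t ≤ sumℕ f
sum-≥-two-terms f {zero} {zero} s≢t = ⊥-elim (s≢t refl)
sum-≥-two-terms f {zero} {suc t} _ = +-monoʳ-≤ (f zero) (sum-≥-term (λ i → f (suc i)) t)
sum-≥-two-terms f {suc s} {zero} _ =
  subst (_≤ sumℕ f) (+-comm (f zero) (f (suc s))) (+-monoʳ-≤ (f zero) (sum-≥-term (λ i → f (suc i)) s))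
sum-≥-two-terms f {suc s} {suc t} s≢t =
  ≤-trans (sum-≥-two-terms (λ i → f (suc i)) (λ e → s≢t (cong suc e))) (m≤n+m _ (f zero))

sum-positive : ∀ {n} (f : Fin n → ℕ) {k} → sumℕ f ≡ suc k → ∃ λ i → f i ≢ 0
sum-positive {suc n} f e with f zero in f₀
... | suc _ = zero , λ f₀≡0 → 0≢1+n (trans (sym f₀≡0) f₀)
... | zero with sum-positive (λ i → f (suc i)) e
...   | i , fi≢0 = suc i , fi≢0

sum-zero-inv : ∀ {n} (f : Fin n → ℕ) → sumℕ f ≡ 0 → ∀ i → f i ≡ 0
sum-zero-inv {suc n} f e zero = m+n≡0⇒m≡0 (f zero) e
sum-zero-inv {suc n} f e (suc i) = sum-zero-inv (λ i → f (suc i)) (m+n≡0⇒n≡0 (f zero) e) i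

sum-ones : ∀ {n} → sumℕ {n} (λ _ → 1) ≡ n
sum-ones {zero} = refl
sum-ones {suc n} = cong suc sum-ones

sumℚ-zero : ∀ {n} {f : Fin n → ℚ} → (∀ i → f i ≡ 0ℚ) → sumℚ f ≡ 0ℚ
sumℚ-zero {zero} h = refl
sumℚ-zero {suc n} {f} h rewrite h zero = trans (ℚ.+-identityˡ _) (sumℚ-zero (λ i → h (suc i)))

sumℚ-single : ∀ {n} {f : Fin n → ℚ} (t : Fin n) → (∀ j → j ≢ t → f j ≡ 0ℚ) → sumℚ f ≡ f t
sumℚ-single {suc n} {f} zero h =
  trans (cong (f zero ℚ.+_) (sumℚ-zero (λ i → h (suc i) (λ ())))) (ℚ.+-identityʳ (f zero))
sumℚ-single {suc n} {f} (suc t) h rewrite h zero (λ ()) =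
  trans (ℚ.+-identityˡ _)
        (sumℚ-single {f = λ i → f (suc i)} t (λ j j≢t → h (suc j) (λ e → j≢t (suc-injective e))))

VSet : ℕ → Set
VSet n = Fin n → Bool

size : ∀ {n} → VSet n → ℕ
size A = sumℕ (λ i → ⟦ A i ⟧)

_∪_ _∩_ : ∀ {n} → VSet n → VSet n → VSet n
(A ∪ B) i = A i ∨ B i
(A ∩ B) i = A i ∧ B i

∁ : ∀ {n} → VSet n → VSet n
∁ A i = not (A i)

⁅_⁆ : ∀ {n} → Fin n → VSet n
⁅ v ⁆ i = ⌊ i ≟ v ⌋

Disjoint : ∀ {n} → VSet n → VSet n → Set
Disjoint A B = ∀ i → (A ∩ B) i ≡ false

size-∪-∩ : ∀ {n} (A B : VSet n) → size (A ∪ B) + size (A ∩ B) ≡ size A + size B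
size-∪-∩ A B = begin
  size (A ∪ B) + size (A ∩ B)   ≡⟨ sum-+ (λ i → ⟦ A i ∨ B i ⟧) (λ i → ⟦ A i ∧ B i ⟧) ⟨
  sumℕ (λ i → ⟦ A i ∨ B i ⟧ + ⟦ A i ∧ B i ⟧)  ≡⟨ sum-cong (λ i → pointwise (A i) (B i)) ⟩
  sumℕ (λ i → ⟦ A i ⟧ + ⟦ B i ⟧)            ≡⟨ sum-+ (λ i → ⟦ A i ⟧) (λ i → ⟦ B i ⟧) ⟩
  size A + size B               ∎
  where
    open ≡-Reasoning
    pointwise : ∀ p q → ⟦ p ∨ q ⟧ + ⟦ p ∧ q ⟧ ≡ ⟦ p ⟧ + ⟦ q ⟧
    pointwise true true = refl
    pointwise true false = refl
    pointwise false q = +-identityʳ ⟦ q ⟧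

size-∪ : ∀ {n} {A B : VSet n} → Disjoint A B → size (A ∪ B) ≡ size A + size B
size-∪ {A = A} {B} disj = begin
  size (A ∪ B)                  ≡⟨ +-identityʳ _ ⟨
  size (A ∪ B) + 0              ≡⟨ cong (size (A ∪ B) +_) (sum-zero (λ i → cong ⟦_⟧ (disj i))) ⟨
  size (A ∪ B) + size (A ∩ B)   ≡⟨ size-∪-∩ A B ⟩
  size A + size B               ∎
  where open ≡-Reasoning

size-⁅⁆ : ∀ {n} (v : Fin n) → size ⁅ v ⁆ ≡ 1
size-⁅⁆ v = trans (sum-single v off) on
  where
    off : ∀ j → j ≢ v → ⟦ ⌊ j ≟ v ⌋ ⟧ ≡ 0
    off j j≢v with j ≟ v
    ... | yes j≡v = ⊥-elim (j≢v j≡v)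
    ... | no _ = refl
    on : ⟦ ⌊ v ≟ v ⌋ ⟧ ≡ 1
    on with v ≟ v
    ... | yes _ = refl
    ... | no v≢v = ⊥-elim (v≢v refl)

disjoint-⁅⁆ : ∀ {n} {A : VSet n} {v} → A v ≡ false → Disjoint A ⁅ v ⁆
disjoint-⁅⁆ {A = A} {v} Av≡false i with i ≟ v
... | yes refl = trans (∧-identityʳ (A v)) Av≡false
... | no _ = ∧-zeroʳ (A i)

size-∁ : ∀ {n} (A : VSet n) → size A + size (∁ A) ≡ n
size-∁ A = trans (sym (sum-+ (λ i → ⟦ A i ⟧) (λ i → ⟦ not (A i) ⟧))) (trans (sum-cong (λ i → pointwise (A i))) sum-ones)
  where
    pointwise : ∀ p → ⟦ p ⟧ + ⟦ not p ⟧ ≡ 1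
    pointwise true = refl
    pointwise false = refl

size-complement : ∀ {n} (A : VSet n) {k} → size A + k ≡ n → size (∁ A) ≡ k
size-complement A size+k≡n = +-cancelˡ-≡ (size A) _ _ (trans (size-∁ A) (sym size+k≡n))

full-of-size : ∀ {n} (A : VSet n) → size A + 0 ≡ n → ∀ i → A i ≡ true
full-of-size A size+0≡n i with A i in Ai | sum-zero-inv _ (size-complement A size+0≡n) i
... | true | _ = refl
... | false | ()

missing-of-size : ∀ {n} (A : VSet n) {k} → size A + suc k ≡ n → ∃ λ z → A z ≡ false
missing-of-size A size+k≡n with sum-positive _ (size-complement A size+k≡n)
... | z , ⟦∁Az⟧≢0 with A z in Az
...   | true = ⊥-elim (⟦∁Az⟧≢0 refl)
...   | false = z , Az

⟦∧⟧-∪ : ∀ a p d q → p ∧ d ≡ false →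
        ⟦ a ∧ ((p ∨ d) ∧ q) ⟧ ≡ ⟦ a ∧ (p ∧ q) ⟧ + ⟦ a ∧ (d ∧ q) ⟧
⟦∧⟧-∪ false p d q _ = refl
⟦∧⟧-∪ true true false q _ = sym (+-identityʳ ⟦ q ⟧)
⟦∧⟧-∪ true false d q _ = refl

-- The edge-level form of inclusion–exclusion: pairs crossing between A and
-- B in either direction are counted within A ∪ B and, when both endpoints
-- lie in both sets, once more within A ∩ B.
⟦∧⟧-∪-∩ : ∀ a p q r s →
          ⟦ a ∧ (p ∧ s) ⟧ + ⟦ a ∧ (q ∧ r) ⟧ ≤ ⟦ a ∧ ((p ∨ q) ∧ (r ∨ s)) ⟧ + ⟦ a ∧ ((p ∧ q) ∧ (r ∧ s)) ⟧
⟦∧⟧-∪-∩ false p q r s = z≤n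
⟦∧⟧-∪-∩ true true true true true = by-computation _ _
⟦∧⟧-∪-∩ true true true true false = by-computation _ _
⟦∧⟧-∪-∩ true true true false true = by-computation _ _
⟦∧⟧-∪-∩ true true true false false = by-computation _ _
⟦∧⟧-∪-∩ true true false true true = by-computation _ _
⟦∧⟧-∪-∩ true true false false true = by-computation _ _
⟦∧⟧-∪-∩ true true false true false = by-computation _ _
⟦∧⟧-∪-∩ true true false false false = by-computation _ _
⟦∧⟧-∪-∩ true false true true s = by-computation _ _
⟦∧⟧-∪-∩ true false true false true = by-computation _ _
⟦∧⟧-∪-∩ true false true false false = by-computation _ _
⟦∧⟧-∪-∩ true false false r s = z≤n

⟦∧⟧-one : ∀ {a b c} → T a → b ≡ true → c ≡ true → 1 ≤ ⟦ a ∧ (b ∧ c) ⟧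
⟦∧⟧-one {true} _ refl refl = ≤-refl

module Edges {n : ℕ} (G : Graph n) where
  open Graph G using (adj)

  adj-sym : ∀ {i j} → Adj G i j → Adj G j i
  adj-sym {i} {j} = subst T (Graph.sym G i j)

  -- The number of adjacent ordered pairs (i, j) with i ∈ A and j ∈ B;
  -- edges Y Y is twice the number of edges inside Y.
  edges : VSet n → VSet n → ℕ
  edges A B = sumℕ λ i → sumℕ λ j → ⟦ adj i j ∧ (A i ∧ B j) ⟧

  sum₂-+ : (f g : Fin n → Fin n → ℕ) →
           sumℕ (λ i → sumℕ (λ j → f i j + g i j)) ≡ sumℕ (λ i → sumℕ (f i)) + sumℕ (λ i → sumℕ (g i))
  sum₂-+ f g = trans (sum-cong (λ i → sum-+ (f i) (g i))) (sum-+ (λ i → sumℕ (f i)) (λ i → sumℕ (g i)))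

  sum₂-mono : {f g : Fin n → Fin n → ℕ} → (∀ i j → f i j ≤ g i j) →
              sumℕ (λ i → sumℕ (f i)) ≤ sumℕ (λ i → sumℕ (g i))
  sum₂-mono h = sum-mono (λ i → sum-mono (h i))

  edges-sym : ∀ A B → edges A B ≡ edges B A
  edges-sym A B = trans (sum-swap (λ i j → ⟦ adj i j ∧ (A i ∧ B j) ⟧)) (sum-cong (λ j → sum-cong (λ i → pointwise i j)))
    where
      pointwise : ∀ i j → ⟦ adj i j ∧ (A i ∧ B j) ⟧ ≡ ⟦ adj j i ∧ (B j ∧ A i) ⟧
      pointwise i j rewrite Graph.sym G i j | ∧-comm (A i) (B j) = refl

  edges-∪ˡ : ∀ {A B} C → Disjoint A B → edges (A ∪ B) C ≡ edges A C + edges B C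
  edges-∪ˡ {A} {B} C disj =
    trans (sum-cong (λ i → sum-cong (λ j → ⟦∧⟧-∪ (adj i j) (A i) (B i) (C j) (disj i)))) (sum₂-+ _ _)

  edges-∪ʳ : ∀ A {B C} → Disjoint B C → edges A (B ∪ C) ≡ edges A B + edges A C
  edges-∪ʳ A {B} {C} disj = begin
    edges A (B ∪ C)         ≡⟨ edges-sym A (B ∪ C) ⟩
    edges (B ∪ C) A         ≡⟨ edges-∪ˡ A disj ⟩
    edges B A + edges C A   ≡⟨ cong₂ _+_ (edges-sym B A) (edges-sym C A) ⟩
    edges A B + edges A C   ∎
    where open ≡-Reasoning

  edges-∪-∩ : ∀ A B → edges A B + edges B A ≤ edges (A ∪ B) (A ∪ B) + edges (A ∩ B) (A ∩ B)
  edges-∪-∩ A B = subst₂ _≤_ (sum₂-+ _ _) (sum₂-+ _ _)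
    (sum₂-mono (λ i j → ⟦∧⟧-∪-∩ (adj i j) (A i) (B i) (A j) (B j)))

  edges-≥-adjacent : ∀ {A B u v} → A u ≡ true → B v ≡ true → Adj G u v → 1 ≤ edges A B
  edges-≥-adjacent {A} {B} {u} {v} Au Bv u~v =
    ≤-trans (⟦∧⟧-one u~v Au Bv) (≤-trans (sum-≥-term _ v) (sum-≥-term _ u))

  edges-empty : ∀ {A} → (∀ i → A i ≡ false) → edges A A ≡ 0
  edges-empty {A} empty = sum-zero (λ i → sum-zero (λ j →
    trans (cong (λ b → ⟦ adj i j ∧ (b ∧ A j) ⟧) (empty i)) (cong ⟦_⟧ (∧-zeroʳ (adj i j)))))

  edges-full : ∀ {A} → (∀ i → A i ≡ true) → edges A A ≡ degreeSum G
  edges-full {A} full = sum-cong (λ i → sum-cong (λ j → pointwise i j))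
    where
      pointwise : ∀ i j → ⟦ adj i j ∧ (A i ∧ A j) ⟧ ≡ bool→ℕ G (adj i j)
      pointwise i j rewrite full i | full j with adj i j
      ... | true = refl
      ... | false = refl

  edges-grow : ∀ {Y u v} → Y u ≡ true → Y v ≡ false → Adj G u v →
               edges Y Y + 2 ≤ edges (Y ∪ ⁅ v ⁆) (Y ∪ ⁅ v ⁆)
  edges-grow {Y} {u} {v} Yu Yv u~v = begin
    edges Y Y + 2                                   ≤⟨ +-monoʳ-≤ (edges Y Y) (+-mono-≤ into-v out-of-v) ⟩
    edges Y Y + (edges Y δ + edges δ Y)             ≡⟨ +-assoc (edges Y Y) _ _ ⟨
    edges Y Y + edges Y δ + edges δ Y               ≤⟨ +-monoʳ-≤ _ (m≤m+n (edges δ Y) (edges δ δ)) ⟩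
    edges Y Y + edges Y δ + (edges δ Y + edges δ δ) ≡⟨ cong₂ _+_ (edges-∪ʳ Y disj) (edges-∪ʳ δ disj) ⟨
    edges Y Y' + edges δ Y'                         ≡⟨ edges-∪ˡ Y' disj ⟨
    edges Y' Y'                                     ∎
    where
      open ≤-Reasoning
      δ = ⁅ v ⁆
      Y' = Y ∪ δ
      disj : Disjoint Y δ
      disj = disjoint-⁅⁆ Yv
      v∈δ : δ v ≡ true
      v∈δ with v ≟ v
      ... | yes _ = refl
      ... | no v≢v = ⊥-elim (v≢v refl)
      into-v : 1 ≤ edges Y δ
      into-v = edges-≥-adjacent {A = Y} {B = δ} Yu v∈δ u~v
      out-of-v : 1 ≤ edges δ Y
      out-of-v = edges-≥-adjacent {A = δ} {B = Y} v∈δ Yu (adj-sym u~v)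

module Tree {n : ℕ} (G : Graph n) (tree : IsTree G) where
  open Graph G using (adj)
  open IsTree tree using (connected) renaming (edges to edge-count)
  open Edges G

  boundary-edge : ∀ {a b} (Y : VSet n) → Star (Adj G) a b → Y a ≡ true → Y b ≡ false →
                  ∃₂ λ u v → Y u ≡ true × Y v ≡ false × Adj G u v
  boundary-edge Y ε Ya Yb with trans (sym Ya) Yb
  ... | ()
  boundary-edge {a} Y (_◅_ {j = c} a~c walk) Ya Yb with Y c in Yc
  ... | true = boundary-edge Y walk Yc Yb
  ... | false = a , c , Ya , Yc , a~c

  -- A nonempty vertex set Y spans at most |Y| - 1 edges, by induction on
  -- the number k of vertices outside Y.
  forest-bound : ∀ k (Y : VSet n) → size Y + k ≡ n → ∀ {y} → Y y ≡ true →
                 edges Y Y + 2 ≤ 2 * size Y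
  forest-bound zero Y size+0≡n _ = ≤-reflexive (begin
    edges Y Y + 2     ≡⟨ cong (_+ 2) (edges-full (full-of-size Y size+0≡n)) ⟩
    degreeSum G + 2   ≡⟨ edge-count ⟩
    2 * n             ≡⟨ cong (2 *_) size≡n ⟨
    2 * size Y        ∎)
    where
      open ≡-Reasoning
      size≡n : size Y ≡ n
      size≡n = trans (sym (+-identityʳ _)) size+0≡n
  forest-bound (suc k) Y size+k≡n {y} Yy with missing-of-size Y size+k≡n
  ... | z , Yz with boundary-edge Y (connected y z) Yy Yz
  ...   | u , v , Yu , Yv , u~v = +-cancelʳ-≤ 2 _ _ (begin
    edges Y Y + 2 + 2   ≤⟨ +-monoˡ-≤ 2 (edges-grow Yu Yv u~v) ⟩
    edges Y' Y' + 2     ≤⟨ forest-bound k Y' size'+k≡n Y'y ⟩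
    2 * size Y'         ≡⟨ cong (2 *_) size' ⟩
    2 * (size Y + 1)    ≡⟨ *-distribˡ-+ 2 (size Y) 1 ⟩
    2 * size Y + 2      ∎)
    where
      open ≤-Reasoning
      Y' = Y ∪ ⁅ v ⁆
      size' : size Y' ≡ size Y + 1
      size' = trans (size-∪ {A = Y} {B = ⁅ v ⁆} (disjoint-⁅⁆ Yv)) (cong (size Y +_) (size-⁅⁆ v))
      size'+k≡n : size Y' + k ≡ n
      size'+k≡n = trans (cong (_+ k) size') (trans (+-assoc (size Y) 1 k) size+k≡n)
      Y'y : Y' y ≡ true
      Y'y = cong (_∨ ⌊ y ≟ v ⌋) Yy

  induced-bound : ∀ Y → edges Y Y ≤ 2 * size Y
  induced-bound Y with any? (λ i → T? (Y i))
  ... | yes (y , Yy) =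
    ≤-trans (m≤m+n (edges Y Y) 2) (forest-bound _ Y (size-∁ Y) (Equivalence.to T-≡ Yy))
  ... | no none = subst (_≤ 2 * size Y) (sym (edges-empty outside)) z≤n
    where
      outside : ∀ i → Y i ≡ false
      outside i with Y i in Yi
      ... | true = ⊥-elim (none (i , subst T (sym Yi) _))
      ... | false = refl

  TwoNeighboursIn : VSet n → Fin n → Set
  TwoNeighboursIn B a = ∃₂ λ s t → s ≢ t × (Adj G a s × B s ≡ true) × (Adj G a t × B t ≡ true)

  edges-≥-rows : ∀ A B → (∀ a → A a ≡ true → TwoNeighboursIn B a) → 2 * size A ≤ edges A B
  edges-≥-rows A B two = subst (_≤ edges A B) (sum-* 2 (λ a → ⟦ A a ⟧)) (sum-mono row)
    where
      row : ∀ a → 2 * ⟦ A a ⟧ ≤ sumℕ (λ j → ⟦ adj a j ∧ (A a ∧ B j) ⟧)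
      row a with A a in Aa
      ... | false = z≤n
      ... | true with two a Aa
      ...   | s , t , s≢t , (a~s , Bs) , (a~t , Bt) =
        ≤-trans (+-mono-≤ (⟦∧⟧-one a~s refl Bs) (⟦∧⟧-one a~t refl Bt)) (sum-≥-two-terms _ s≢t)

  expansion : ∀ (A B : VSet n) → (∃ λ a → A a ≡ true) →
              (∀ a → A a ≡ true → TwoNeighboursIn B a) → size A < size B
  expansion A B (a , Aa) two =
    +-cancelˡ-≤ (size A) _ _ (*-cancelˡ-≤ 2 (begin
      2 * (size A + suc (size A))                ≡⟨ doubled (size A) ⟩
      2 * size A + 2 * size A + 2                ≤⟨ +-monoˡ-≤ 2 (+-mono-≤ rows rows) ⟩
      edges A B + edges A B + 2                  ≡⟨ cong (λ e → edges A B + e + 2) (edges-sym A B) ⟩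
      edges A B + edges B A + 2                  ≤⟨ +-monoˡ-≤ 2 (edges-∪-∩ A B) ⟩
      edges X X + edges Z Z + 2                  ≡⟨ swap-last (edges X X) (edges Z Z) 2 ⟩
      edges X X + 2 + edges Z Z                  ≤⟨ +-mono-≤ (forest-bound _ X (size-∁ X) (cong (_∨ B a) Aa)) (induced-bound Z) ⟩
      2 * size X + 2 * size Z                    ≡⟨ *-distribˡ-+ 2 (size X) (size Z) ⟨
      2 * (size X + size Z)                      ≡⟨ cong (2 *_) (size-∪-∩ A B) ⟩
      2 * (size A + size B)                      ∎))
    where
      open ≤-Reasoning
      X = A ∪ B
      Z = A ∩ B
      rows : 2 * size A ≤ edges A B
      rows = edges-≥-rows A B two
      doubled : ∀ a → 2 * (a + suc a) ≡ 2 * a + 2 * a + 2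
      doubled = solve-∀
      swap-last : ∀ x z c → x + z + c ≡ x + c + z
      swap-last = solve-∀

-- If x is a null vector and u is adjacent to t with x_t ≠ 0, then u has a
-- second neighbour t' with x_t' ≠ 0: otherwise (Ax)_u = x_t.
second-support-neighbour : ∀ {n} (G : Graph n) {x : Fin n → ℚ} → InNullSpace G x →
  ∀ {u t} → Adj G u t → x t ≢ 0ℚ → ∃ λ t' → t' ≢ t × Adj G u t' × x t' ≢ 0ℚ
second-support-neighbour G {x} null {u} {t} u~t xt≢0
  with any? (λ j → ¬? (j ≟ t) ×-dec T? (Graph.adj G u j) ×-dec ¬? (x j ℚ.≟ 0ℚ))
... | yes found = found
... | no none = ⊥-elim (xt≢0 (begin
  x t                                  ≡⟨ ℚ.*-identityˡ (x t) ⟨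
  1ℚ ℚ.* x t                           ≡⟨ A-ut ⟨
  A G u t ℚ.* x t                      ≡⟨ sumℚ-single t other-terms-vanish ⟨
  sumℚ (λ j → A G u j ℚ.* x j)         ≡⟨ null u ⟩
  0ℚ                                   ∎))
  where
    open ≡-Reasoning
    open Graph G using (adj)
    A-ut : A G u t ℚ.* x t ≡ 1ℚ ℚ.* x t
    A-ut rewrite Equivalence.to T-≡ u~t = refl
    other-terms-vanish : ∀ j → j ≢ t → A G u j ℚ.* x j ≡ 0ℚ
    other-terms-vanish j j≢t with adj u j in uj
    ... | false = ℚ.*-zeroˡ (x j)
    ... | true with x j ℚ.≟ 0ℚ
    ...   | yes xj≡0 = cong (1ℚ ℚ.*_) xj≡0
    ...   | no xj≢0 = ⊥-elim (none (j , j≢t , subst T (sym uj) _ , xj≢0))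

∣∣≡size : ∀ {n} (p : Subset n) → ∣ p ∣ ≡ size (lookup p)
∣∣≡size [] = refl
∣∣≡size (true ∷ p) = cong suc (∣∣≡size p)
∣∣≡size (false ∷ p) = ∣∣≡size p

mainTheorem14 : ∀ {n : ℕ} (S : Graph n) → IsTree S → IsSTree S →
    (U : Subset n) → (∀ u → u ∈ U → InCore S u) → Nonempty U →
    (W : Subset n) → (∀ v → (v ∈ W) ⇔ (InN S (λ u → u ∈ U) v × InSupp S v)) →
    ∣ U ∣ < ∣ W ∣
mainTheorem14 S tree _ U core (u₀ , u₀∈U) W W-spec =
  subst₂ _<_ (sym (∣∣≡size U)) (sym (∣∣≡size W))
    (expansion (lookup U) (lookup W) (u₀ , []=⇒lookup u₀∈U) two-neighbours)
  where
    open Tree S tree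
    open Edges S using (adj-sym)
    in-W : ∀ {u v} → u ∈ U → Adj S u v → InSupp S v → lookup W v ≡ true
    in-W {u} {v} u∈U u~v supp = []=⇒lookup (Equivalence.from (W-spec v) ((u , u∈U , u~v) , supp))
    -- A core vertex u ∈ U sees a support vertex t and, by the null-space
    -- lemma, a second one t'; both lie in W.
    two-neighbours : ∀ u → lookup U u ≡ true → TwoNeighboursIn (lookup W) u
    two-neighbours u Uu with core u (lookup⇒[]= u U Uu)
    ... | t , (x , null , xt≢0) , t~u with second-support-neighbour S null (adj-sym t~u) xt≢0
    ...   | t' , t'≢t , u~t' , xt'≢0 =
      t' , t , t'≢t , (u~t' , in-W u∈U u~t' (x , null , xt'≢0)) , (adj-sym t~u , in-W u∈U (adj-sym t~u) (x , null , xt≢0))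
      where u∈U = lookup⇒[]= u U Uu
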